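{- Let $s,t\ge 3$ be integers and $d$ an integer with $1\le d\le\lfloor t/2\rfloor$ and $\gcd(t,d)=1$. Let $\varphi$ be the cyclic $d$-shift of $C_t$ and $G=C_s\Box^{\varphi}C_t$. Let $(x_0,y_0)$ be the unique integer solution of $(t-d)x-ty=1$ with $0\le x_0\le t-1$. Then $G$ is isomorphic to the circulant graph $C(\mathbb{Z}_{st},\{1,sx_0\})$.
   Context: The cycle $C_t$ has vertex set $\{1,\dots,t\}$ with $j$ adjacent to $j\pm 1$ (mod $t$). The cyclic $d$-shift of $C_t$ is the automorphism $j\mapsto j+d\pmod t$. For an automorphism $\varphi$ of $C_t$, the Cartesian graph bundle $C_s\Box^{\varphi}C_t$ is the graph with vertex set $\{(i,j):1\le i\le s,\ 1\le j\le t\}$ and edges: $(i,j)\sim(i,j+1)$ (second coordinate mod $t$) for all $i,j$; $(i,j)\sim(i+1,j)$ for $1\le i\le s-1$ and all $j$; and $(s,j)\sim(1,\varphi(j))$ for all $j$. For a positive integer $n$ and a set $S$ of integers, the circulant graph $C(\mathbb{Z}_n,S)$ has vertex set $\{1,\dots,n\}$, with two vertices $i,j$ adjacent iff $i-j\equiv \pm k\pmod n$ for some $k\in S$. -}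

module Defs where

open import Data.Nat as ℕ using (ℕ; _∸_)
open import Data.Integer as ℤ using (ℤ; +_; _-_)
open import Data.Integer.Divisibility using (_∣_)
open import Data.Fin using (Fin; toℕ)
open import Data.Product using (_×_; _,_; Σ)
open import Data.Sum using (_⊎_)
open import Data.List using (List)
open import Data.List.Relation.Unary.Any using (Any)
open import Relation.Binary.PropositionalEquality using (_≡_)
open import Function.Bundles using (_⤖_; _⇔_; Bijection)
open import Level using (0ℓ; suc)

record Graph : Set₁ where
  field
    V   : Set
    Adj : V → V → Set

open Graph public

-- Integer value of a vertex index (vertices are 0-indexed: Fin n stands for {1,…,n}
-- via k ↦ k+1; the constructions below are invariant under this relabelling).
⟦_⟧ : ∀ {n} → Fin n → ℤ
⟦ j ⟧ = + toℕ j

sym-closure : ∀ {A : Set} → (A → A → Set) → A → A → Set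
sym-closure E u v = E u v ⊎ E v u

bundleEdge : (s t : ℕ) (d : ℤ) → Fin s × Fin t → Fin s × Fin t → Set
bundleEdge s t d (i , j) (i' , j') =
  (i ≡ i' × (+ t) ∣ (⟦ j' ⟧ - ⟦ j ⟧ - + 1))
  ⊎
  ((toℕ i' ≡ ℕ.suc (toℕ i)) × j ≡ j')
  ⊎ -- (s,j) ~ (1, φ(j)) with φ(j) = j + d mod t
  ((toℕ i ≡ s ∸ 1) × (toℕ i' ≡ 0) × (+ t) ∣ (⟦ j' ⟧ - ⟦ j ⟧ - d))

CycleBundleShift : (s t : ℕ) (d : ℤ) → Graph
CycleBundleShift s t d = record
  { V = Fin s × Fin t
  ; Adj = sym-closure (bundleEdge s t d) }

Circulant : (n : ℕ) → List ℤ → Graph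
Circulant n S = record
  { V = Fin n
  ; Adj = λ i j → Any (λ k → ((+ n) ∣ (⟦ i ⟧ - ⟦ j ⟧ - k)) ⊎ ((+ n) ∣ (⟦ i ⟧ - ⟦ j ⟧ ℤ.+ k))) S }

record _≅_ (G H : Graph) : Set₁ where
  field
    bij : V G ⤖ V H
    adj : ∀ u v → Adj G u v ⇔ Adj H (Bijection.to bij u) (Bijection.to bij v)

-- Number the vertex (i, j) of the bundle by i + s·block(j) ∈ ℤ_{st}, where block(j) ≡ -x₀ j (mod t).
-- The Bézout identity says -x₀ is the inverse of d modulo t, so block is a bijection of ℤ_t with
-- inverse b ↦ d b, and the numbering is a bijection onto ℤ_{st} (two-digit mixed radix, base s).
-- Moving (i, j) → (i, j+1) inside a fibre changes block by -x₀, i.e. the number by -s x₀; moving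
-- (i, j) → (i+1, j) adds 1, and so does the twisted step (s, j) → (1, j+d), because
-- block(j+d) = block(j) + 1 carries the overflow of the first digit into the second. Hence bundle
-- edges are exactly the edges of C(ℤ_{st}, {1, s x₀}).
module Submission where

open import Data.Nat as ℕ using (ℕ; zero; suc; NonZero; _<_)
import Data.Nat.Properties as ℕ
import Data.Nat.DivMod as ℕ
import Data.Nat.Divisibility as ℕ
open import Data.Nat.GCD using (gcd)
open import Data.Integer as ℤ using (ℤ; +_; _-_; _+_; _*_; -_; ∣_∣; 0ℤ; 1ℤ)
import Data.Integer.Properties as ℤ
open import Data.Integer.DivMod using (_%ℕ_; _/ℕ_; n%ℕd<d; a≡a%ℕn+[a/ℕn]*n)
import Data.Integer.Divisibility as Unsigned
open import Data.Integer.Divisibility.Signed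
open import Data.Integer.Tactic.RingSolver using (solve-∀; solve)
open import Data.Fin as Fin using (Fin; toℕ; fromℕ<)
import Data.Fin.Properties as Fin
open import Data.List using (_∷_; [])
open import Data.List.Relation.Unary.Any using (here; there)
open import Data.Product using (_×_; _,_; ∃; map; map₂; uncurry)
open import Data.Sum using (_⊎_; inj₁; inj₂)
open import Data.Sum.Function.Propositional using (_⊎-⇔_)
open import Function using (_∘_; _⇔_; Equivalence; mk⇔; mk⤖)
open import Function.Consequences.Propositional using (strictlySurjective⇒surjective)
open import Relation.Binary.Structures using (IsEquivalence)
open import Relation.Binary.Bundles using (Setoid)
open import Relation.Binary.PropositionalEquality as ≡ using (_≡_; refl; cong; cong₂; subst; subst₂)
open import Relation.Nullary using (yes; no; contradiction)
import Relation.Binary.Reasoning.Setoid as SetoidReasoning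

open import Defs

infix 4 _≡_mod_

-- A record rather than a synonym for the divisibility, so that a and b can be inferred.
record _≡_mod_ (a b : ℤ) (n : ℕ) : Set where
  constructor mod-by
  field divides-difference : + n ∣ (a - b)

open _≡_mod_

module _ {n : ℕ} where

  private
    ∣-by : ∀ {y a b} → y ≡ a - b → + n ∣ y → a ≡ b mod n
    ∣-by refl = mod-by

  ≡⇒≡-mod : ∀ {a b} → a ≡ b → a ≡ b mod n
  ≡⇒≡-mod {a} refl = ∣-by (≡.sym (ℤ.+-inverseʳ a)) (∣n⇒∣m*n 0ℤ ∣-refl)

  ≡-mod-sym : ∀ {a b} → a ≡ b mod n → b ≡ a mod n
  ≡-mod-sym {a} {b} = ∣-by (swap a b) ∘ ∣m⇒∣-m ∘ divides-difference
    where swap : ∀ a b → - (a - b) ≡ b - a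
          swap = solve-∀

  ≡-mod-trans : ∀ {a b c} → a ≡ b mod n → b ≡ c mod n → a ≡ c mod n
  ≡-mod-trans {a} {b} {c} a≡b b≡c =
    ∣-by (ℤ.+-minus-telescope a b c) (∣m∣n⇒∣m+n (divides-difference a≡b) (divides-difference b≡c))

  ≡-mod-resp : ∀ {a a′ b b′} → a ≡ a′ → b ≡ b′ → a ≡ b mod n → a′ ≡ b′ mod n
  ≡-mod-resp = subst₂ (λ a b → a ≡ b mod n)

  ≡-mod-isEquivalence : IsEquivalence (λ a b → a ≡ b mod n)
  ≡-mod-isEquivalence = record { refl = ≡⇒≡-mod refl ; sym = ≡-mod-sym ; trans = ≡-mod-trans }

  ≡-mod-setoid : Setoid _ _
  ≡-mod-setoid = record { isEquivalence = ≡-mod-isEquivalence }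

  +-cong-mod : ∀ {a b c d} → a ≡ b mod n → c ≡ d mod n → a + c ≡ b + d mod n
  +-cong-mod {a} {b} {c} {d} a≡b c≡d =
    ∣-by (regroup a b c d) (∣m∣n⇒∣m+n (divides-difference a≡b) (divides-difference c≡d))
    where regroup : ∀ a b c d → (a - b) + (c - d) ≡ (a + c) - (b + d)
          regroup = solve-∀

  +-congˡ-mod : ∀ c {a b} → a ≡ b mod n → c + a ≡ c + b mod n
  +-congˡ-mod c = +-cong-mod (≡⇒≡-mod {c} refl)

  +-cancelˡ-mod : ∀ c {a b} → c + a ≡ c + b mod n → a ≡ b mod n
  +-cancelˡ-mod c {a} {b} = ∣-by (cancel c a b) ∘ divides-difference
    where cancel : ∀ c a b → (c + a) - (c + b) ≡ a - b
          cancel = solve-∀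

  *-congˡ-mod : ∀ k {a b} → a ≡ b mod n → k * a ≡ k * b mod n
  *-congˡ-mod k {a} {b} = ∣-by (distrib k a b) ∘ ∣n⇒∣m*n k ∘ divides-difference
    where distrib : ∀ k a b → k * (a - b) ≡ k * a - k * b
          distrib = solve-∀

  *-congʳ-mod : ∀ k {a b} → a ≡ b mod n → a * k ≡ b * k mod n
  *-congʳ-mod k {a} {b} = ∣-by (distrib k a b) ∘ ∣n⇒∣m*n k ∘ divides-difference
    where distrib : ∀ k a b → k * (a - b) ≡ a * k - b * k
          distrib = solve-∀

  ≡-mod-transpose : ∀ {a b} c → a ≡ b + c mod n → b ≡ a + - c mod n
  ≡-mod-transpose {a} {b} c = ∣-by (transpose a b c) ∘ ∣m⇒∣-m ∘ divides-difference
    where transpose : ∀ a b c → - (a - (b + c)) ≡ b - (a + - c)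
          transpose = solve-∀

  +-multiple-≡-mod : ∀ a c → a + + n * c ≡ a mod n
  +-multiple-≡-mod a c = ∣-by (cancel a (+ n) c) (∣m⇒∣m*n c ∣-refl)
    where cancel : ∀ a n c → n * c ≡ a + n * c - a
          cancel = solve-∀

  %ℕ-≡-mod : ∀ z .{{_ : NonZero n}} → + (z %ℕ n) ≡ z mod n
  %ℕ-≡-mod z = ≡-mod-sym (mod-by (divides (z /ℕ n) (begin
    z - + (z %ℕ n)                           ≡⟨ cong (_- + (z %ℕ n)) (a≡a%ℕn+[a/ℕn]*n z n) ⟩
    + (z %ℕ n) + (z /ℕ n) * + n - + (z %ℕ n) ≡⟨ cancel (+ (z %ℕ n)) ((z /ℕ n) * + n) ⟩
    (z /ℕ n) * + n                           ∎)))
    where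
    open ≡.≡-Reasoning
    cancel : ∀ r m → r + m - r ≡ m
    cancel = solve-∀

  ≡-mod⇒≡ : ∀ {a b} → a < n → b < n → + a ≡ + b mod n → a ≡ b
  ≡-mod⇒≡ {a} {b} a<n b<n (mod-by n∣a-b) =
    ℤ.+-injective (ℤ.i-j≡0⇒i≡j (+ a) (+ b) (ℤ.∣i∣≡0⇒i≡0 (below-modulus (∣⇒∣ᵤ n∣a-b) distance<n)))
    where
    distance<n : ∣ + a - + b ∣ < n
    distance<n = subst (_< n) (cong ∣_∣ (≡.sym (ℤ.[+m]-[+n]≡m⊖n a b)))
                       (ℕ.≤-<-trans (ℤ.∣m⊝n∣≤m⊔n a b) (ℕ.⊔-lub a<n b<n))
    below-modulus : ∀ {m} → n ℕ.∣ m → m < n → m ≡ 0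
    below-modulus {zero}  _   _   = refl
    below-modulus {suc m} n∣m m<n = contradiction n∣m (ℕ.>⇒∤ m<n)

  ∣ᵤ-minus⇔ : ∀ a b c → (+ n Unsigned.∣ (a - b - c)) ⇔ (a ≡ b + c mod n)
  ∣ᵤ-minus⇔ a b c =
    mk⇔ (∣-by (regroup a b c) ∘ ∣ᵤ⇒∣) (∣⇒∣ᵤ ∘ subst (+ n ∣_) (≡.sym (regroup a b c)) ∘ divides-difference)
    where regroup : ∀ a b c → a - b - c ≡ a - (b + c)
          regroup = solve-∀

  ∣ᵤ-plus⇔ : ∀ a b c → (+ n Unsigned.∣ (a - b + c)) ⇔ (b ≡ a + c mod n)
  ∣ᵤ-plus⇔ a b c = mk⇔ (∣-by (negate a b c) ∘ ∣m⇒∣-m ∘ ∣ᵤ⇒∣)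
    (∣⇒∣ᵤ ∘ subst (+ n ∣_) (negate′ a b c) ∘ ∣m⇒∣-m ∘ divides-difference)
    where negate : ∀ a b c → - (a - b + c) ≡ b - (a + c)
          negate = solve-∀
          negate′ : ∀ a b c → - (b - (a + c)) ≡ a - b + c
          negate′ = solve-∀

module ≡-mod-Reasoning (n : ℕ) = SetoidReasoning (≡-mod-setoid {n})

≡-mod-linear-step : ∀ {n} m {y y′ z z′ c} → y ≡ m * z mod n → y′ ≡ m * z′ mod n →
                    z′ ≡ z + c mod n → y′ ≡ y + m * c mod n
≡-mod-linear-step {n} m {y} {y′} {z} {z′} {c} y≡mz y′≡mz′ z′≡z+c = begin
  y′            ≈⟨ y′≡mz′ ⟩
  m * z′        ≈⟨ *-congˡ-mod m z′≡z+c ⟩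
  m * (z + c)   ≡⟨ ℤ.*-distribˡ-+ m z c ⟩
  m * z + m * c ≈⟨ +-cong-mod (≡-mod-sym y≡mz) (≡⇒≡-mod refl) ⟩
  y + m * c     ∎
  where open ≡-mod-Reasoning n

module _ {m n : ℕ} where

  *-mono-mod : ∀ {a b} → a ≡ b mod n → + m * a ≡ + m * b mod (m ℕ.* n)
  *-mono-mod {a} {b} (mod-by n∣a-b) =
    mod-by (subst₂ _∣_ (≡.sym (ℤ.pos-* m n)) (distrib (+ m) a b) (*-monoʳ-∣ (+ m) n∣a-b))
    where distrib : ∀ k a b → k * (a - b) ≡ k * a - k * b
          distrib = solve-∀

  *-cancel-mod : ∀ {a b} .{{_ : NonZero m}} → + m * a ≡ + m * b mod (m ℕ.* n) → a ≡ b mod n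
  *-cancel-mod {a} {b} (mod-by mn∣ma-mb) =
    mod-by (*-cancelˡ-∣ (+ m) (subst₂ _∣_ (ℤ.pos-* m n) (distrib (+ m) a b) mn∣ma-mb))
    where distrib : ∀ k a b → k * a - k * b ≡ k * (a - b)
          distrib = solve-∀

  ≡-mod-weakenˡ : ∀ {a b} → a ≡ b mod (m ℕ.* n) → a ≡ b mod m
  ≡-mod-weakenˡ (mod-by mn∣a-b) =
    mod-by (∣-trans (divides (+ n) (≡.trans (ℤ.pos-* m n) (ℤ.*-comm (+ m) (+ n)))) mn∣a-b)

mixed-radix-cong : ∀ {s t} a {b b′} → b ≡ b′ mod t → a + + s * b ≡ a + + s * b′ mod (s ℕ.* t)
mixed-radix-cong {s} a b≡b′ = +-congˡ-mod a (*-mono-mod {m = s} b≡b′)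

mixed-radix-injective : ∀ {s t a a′} {b b′ : ℤ} .{{_ : NonZero s}} → a < s → a′ < s →
  + a + + s * b ≡ + a′ + + s * b′ mod (s ℕ.* t) → a ≡ a′ × (b ≡ b′ mod t)
mixed-radix-injective {s} {t} {a} {a′} {b} {b′} a<s a′<s eq =
  a≡a′ , *-cancel-mod (+-cancelˡ-mod (+ a) (subst (λ c → + a + + s * b ≡ + c + + s * b′ mod (s ℕ.* t))
                                              (≡.sym a≡a′) eq))
  where
  a≡a′ : a ≡ a′
  a≡a′ = ≡-mod⇒≡ a<s a′<s (begin
    + a                ≈⟨ ≡-mod-sym (+-multiple-≡-mod (+ a) b) ⟩
    + a + + s * b      ≈⟨ ≡-mod-weakenˡ eq ⟩
    + a′ + + s * b′    ≈⟨ +-multiple-≡-mod (+ a′) b′ ⟩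
    + a′               ∎)
    where open ≡-mod-Reasoning s

CirculantStep : ∀ {n} {A : Set} → (A → Fin n) → ℤ → A → A → Set
CirculantStep {n} f g u v = ⟦ f u ⟧ ≡ ⟦ f v ⟧ + g mod n ⊎ ⟦ f v ⟧ ≡ ⟦ f u ⟧ + 1ℤ mod n

sym-closure⇔circulant : ∀ {n} {A : Set} {E : A → A → Set} (f : A → Fin n) (g : ℤ) →
  (∀ u v → E u v ⇔ CirculantStep f g u v) →
  ∀ u v → sym-closure E u v ⇔ Adj (Circulant n (1ℤ ∷ g ∷ [])) (f u) (f v)
sym-closure⇔circulant {n} {A} {E} f g E⇔step u v = mk⇔ forth back
  where
  open Equivalence
  forth : sym-closure E u v → Adj (Circulant n (1ℤ ∷ g ∷ [])) (f u) (f v)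
  forth (inj₁ e) with E⇔step u v .to e
  ... | inj₁ p = there (here (inj₁ (∣ᵤ-minus⇔ ⟦ f u ⟧ ⟦ f v ⟧ g .from p)))
  ... | inj₂ p = here (inj₂ (∣ᵤ-plus⇔ ⟦ f u ⟧ ⟦ f v ⟧ 1ℤ .from p))
  forth (inj₂ e) with E⇔step v u .to e
  ... | inj₁ p = there (here (inj₂ (∣ᵤ-plus⇔ ⟦ f u ⟧ ⟦ f v ⟧ g .from p)))
  ... | inj₂ p = here (inj₁ (∣ᵤ-minus⇔ ⟦ f u ⟧ ⟦ f v ⟧ 1ℤ .from p))
  back : Adj (Circulant n (1ℤ ∷ g ∷ [])) (f u) (f v) → sym-closure E u v
  back (here (inj₁ p))         = inj₂ (E⇔step v u .from (inj₂ (∣ᵤ-minus⇔ ⟦ f u ⟧ ⟦ f v ⟧ 1ℤ .to p)))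
  back (here (inj₂ p))         = inj₁ (E⇔step u v .from (inj₂ (∣ᵤ-plus⇔ ⟦ f u ⟧ ⟦ f v ⟧ 1ℤ .to p)))
  back (there (here (inj₁ p))) = inj₁ (E⇔step u v .from (inj₁ (∣ᵤ-minus⇔ ⟦ f u ⟧ ⟦ f v ⟧ g .to p)))
  back (there (here (inj₂ p))) = inj₂ (E⇔step v u .from (inj₁ (∣ᵤ-plus⇔ ⟦ f u ⟧ ⟦ f v ⟧ g .to p)))
  back (there (there ()))

module ShiftBundle (s t : ℕ) {{_ : NonZero s}} {{_ : NonZero t}} (d x : ℤ)
                   (inverse : d * x ≡ - 1ℤ mod t) where

  -x*d≡1 : - x * d ≡ 1ℤ mod t
  -x*d≡1 = begin
    - x * d           ≡⟨ solve (x ∷ d ∷ []) ⟩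
    - 1ℤ * (d * x)    ≈⟨ *-congˡ-mod (- 1ℤ) inverse ⟩
    - 1ℤ * - 1ℤ       ≡⟨⟩
    1ℤ                ∎
    where open ≡-mod-Reasoning t

  block : Fin t → ℕ
  block j = (- x * ⟦ j ⟧) %ℕ t

  block<t : ∀ j → block j < t
  block<t j = n%ℕd<d (- x * ⟦ j ⟧) t

  block≡-x* : ∀ j → + block j ≡ - x * ⟦ j ⟧ mod t
  block≡-x* j = %ℕ-≡-mod (- x * ⟦ j ⟧)

  ⟦⟧≡d*block : ∀ j → ⟦ j ⟧ ≡ d * + block j mod t
  ⟦⟧≡d*block j = begin
    ⟦ j ⟧                ≡⟨ ℤ.*-identityˡ ⟦ j ⟧ ⟨
    1ℤ * ⟦ j ⟧           ≈⟨ *-congʳ-mod ⟦ j ⟧ -x*d≡1 ⟨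
    - x * d * ⟦ j ⟧      ≡⟨ reassociate x d ⟦ j ⟧ ⟩
    d * (- x * ⟦ j ⟧)    ≈⟨ *-congˡ-mod d (block≡-x* j) ⟨
    d * + block j        ∎
    where
    open ≡-mod-Reasoning t
    reassociate : ∀ x d j → - x * d * j ≡ d * (- x * j)
    reassociate = solve-∀

  block-step : ∀ {j j′ c} → ⟦ j′ ⟧ ≡ ⟦ j ⟧ + c mod t → + block j′ ≡ + block j + - x * c mod t
  block-step {j} {j′} = ≡-mod-linear-step (- x) (block≡-x* j) (block≡-x* j′)

  block-step⁻¹ : ∀ {j j′ c} → + block j′ ≡ + block j + c mod t → ⟦ j′ ⟧ ≡ ⟦ j ⟧ + d * c mod t
  block-step⁻¹ {j} {j′} = ≡-mod-linear-step d (⟦⟧≡d*block j) (⟦⟧≡d*block j′)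

  block-injective : ∀ {j j′} → + block j ≡ + block j′ mod t → j ≡ j′
  block-injective {j} {j′} eq = Fin.toℕ-injective (≡-mod⇒≡ (Fin.toℕ<n j) (Fin.toℕ<n j′) (begin
    ⟦ j ⟧          ≈⟨ ⟦⟧≡d*block j ⟩
    d * + block j  ≈⟨ *-congˡ-mod d eq ⟩
    d * + block j′ ≈⟨ ⟦⟧≡d*block j′ ⟨
    ⟦ j′ ⟧         ∎))
    where open ≡-mod-Reasoning t

  unblock : ℕ → Fin t
  unblock q = fromℕ< (n%ℕd<d (d * + q) t)

  block∘unblock : ∀ {q} → q < t → block (unblock q) ≡ q
  block∘unblock {q} q<t = ≡-mod⇒≡ (block<t (unblock q)) q<t (begin
    + block (unblock q)          ≈⟨ block≡-x* (unblock q) ⟩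
    - x * ⟦ unblock q ⟧          ≡⟨ cong (λ r → - x * + r) (Fin.toℕ-fromℕ< (n%ℕd<d (d * + q) t)) ⟩
    - x * + ((d * + q) %ℕ t)     ≈⟨ *-congˡ-mod (- x) (%ℕ-≡-mod (d * + q)) ⟩
    - x * (d * + q)              ≡⟨ ℤ.*-assoc (- x) d (+ q) ⟨
    - x * d * + q                ≈⟨ *-congʳ-mod (+ q) -x*d≡1 ⟩
    1ℤ * + q                     ≡⟨ ℤ.*-identityˡ (+ q) ⟩
    + q                          ∎)
    where open ≡-mod-Reasoning t

  block-right⇔ : ∀ {j j′} → ⟦ j′ ⟧ ≡ ⟦ j ⟧ + 1ℤ mod t ⇔ + block j ≡ + block j′ + x mod t
  block-right⇔ {j} {j′} = mk⇔ forth back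
    where
    open ≡-mod-Reasoning t
    forth : ⟦ j′ ⟧ ≡ ⟦ j ⟧ + 1ℤ mod t → + block j ≡ + block j′ + x mod t
    forth j′≡j+1 = begin
      + block j                    ≈⟨ ≡-mod-transpose (- x * 1ℤ) (block-step j′≡j+1) ⟩
      + block j′ + - (- x * 1ℤ)    ≡⟨ cong (λ c → + block j′ + c) (simplify x) ⟩
      + block j′ + x               ∎
      where simplify : ∀ x → - (- x * 1ℤ) ≡ x
            simplify = solve-∀
    back : + block j ≡ + block j′ + x mod t → ⟦ j′ ⟧ ≡ ⟦ j ⟧ + 1ℤ mod t
    back bj≡bj′+x = begin
      ⟦ j′ ⟧                ≈⟨ ≡-mod-transpose (d * x) (block-step⁻¹ bj≡bj′+x) ⟩
      ⟦ j ⟧ + - (d * x)     ≡⟨ cong (λ c → ⟦ j ⟧ + c) (ℤ.neg-distribʳ-* d x) ⟩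
      ⟦ j ⟧ + d * - x       ≡⟨ cong (λ c → ⟦ j ⟧ + c) (ℤ.*-comm d (- x)) ⟩
      ⟦ j ⟧ + - x * d       ≈⟨ +-congˡ-mod ⟦ j ⟧ -x*d≡1 ⟩
      ⟦ j ⟧ + 1ℤ            ∎

  block-wrap⇔ : ∀ {j j′} → ⟦ j′ ⟧ ≡ ⟦ j ⟧ + d mod t ⇔ + block j′ ≡ + block j + 1ℤ mod t
  block-wrap⇔ {j} {j′} = mk⇔
    (λ j′≡j+d → ≡-mod-trans (block-step j′≡j+d) (+-congˡ-mod (+ block j) -x*d≡1))
    (subst (λ c → ⟦ j′ ⟧ ≡ ⟦ j ⟧ + c mod t) (ℤ.*-identityʳ d) ∘ block-step⁻¹)

  label<st : ∀ (i : Fin s) j → toℕ i ℕ.+ s ℕ.* block j < s ℕ.* t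
  label<st i j = begin-strict
    toℕ i ℕ.+ s ℕ.* block j  <⟨ ℕ.+-monoˡ-< (s ℕ.* block j) (Fin.toℕ<n i) ⟩
    s ℕ.+ s ℕ.* block j      ≡⟨ ℕ.*-suc s (block j) ⟨
    s ℕ.* suc (block j)      ≤⟨ ℕ.*-monoʳ-≤ s (block<t j) ⟩
    s ℕ.* t                  ∎
    where open ℕ.≤-Reasoning

  label : Fin s × Fin t → Fin (s ℕ.* t)
  label (i , j) = fromℕ< (label<st i j)

  toℕ-label : ∀ i j → toℕ (label (i , j)) ≡ toℕ i ℕ.+ s ℕ.* block j
  toℕ-label i j = Fin.toℕ-fromℕ< (label<st i j)

  ⟦label⟧ : ∀ i j → ⟦ label (i , j) ⟧ ≡ ⟦ i ⟧ + + s * + block j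
  ⟦label⟧ i j = begin
    + toℕ (label (i , j))          ≡⟨ cong +_ (toℕ-label i j) ⟩
    + (toℕ i ℕ.+ s ℕ.* block j)    ≡⟨ ℤ.pos-+ (toℕ i) (s ℕ.* block j) ⟩
    ⟦ i ⟧ + + (s ℕ.* block j)      ≡⟨ cong (λ b → ⟦ i ⟧ + b) (ℤ.pos-* s (block j)) ⟩
    ⟦ i ⟧ + + s * + block j        ∎
    where open ≡.≡-Reasoning

  ⟦label⟧-at : ∀ {i a} j → toℕ i ≡ a → ⟦ label (i , j) ⟧ ≡ + a + + s * + block j
  ⟦label⟧-at {i} j refl = ⟦label⟧ i j

  ⟦label⟧+s* : ∀ i j c → ⟦ label (i , j) ⟧ + + s * c ≡ ⟦ i ⟧ + + s * (+ block j + c)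
  ⟦label⟧+s* i j c = ≡.trans (cong (λ a → a + + s * c) (⟦label⟧ i j)) (regroup ⟦ i ⟧ (+ s) (+ block j) c)
    where regroup : ∀ a s b c → a + s * b + s * c ≡ a + s * (b + c)
          regroup = solve-∀

  ⟦label⟧+1 : ∀ i j → ⟦ label (i , j) ⟧ + 1ℤ ≡ + suc (toℕ i) + + s * + block j
  ⟦label⟧+1 i j = ≡.trans (cong (_+ 1ℤ) (⟦label⟧ i j)) (regroup ⟦ i ⟧ (+ s * + block j))
    where regroup : ∀ a b → a + b + 1ℤ ≡ 1ℤ + a + b
          regroup = solve-∀

  ⟦last-label⟧+1 : ∀ {i} j → toℕ i ≡ s ℕ.∸ 1 → ⟦ label (i , j) ⟧ + 1ℤ ≡ 0ℤ + + s * (+ block j + 1ℤ)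
  ⟦last-label⟧+1 {i} j last = begin
    ⟦ label (i , j) ⟧ + 1ℤ            ≡⟨ ⟦label⟧+1 i j ⟩
    + suc (toℕ i) + + s * + block j   ≡⟨ cong (λ a → + a + + s * + block j) (≡.trans (cong suc last) (ℕ.suc-pred s)) ⟩
    + s + + s * + block j             ≡⟨ regroup (+ s) (+ block j) ⟩
    0ℤ + + s * (+ block j + 1ℤ)       ∎
    where
    open ≡.≡-Reasoning
    regroup : ∀ s b → s + s * b ≡ 0ℤ + s * (b + 1ℤ)
    regroup = solve-∀

  label-injective : ∀ {u v} → label u ≡ label v → u ≡ v
  label-injective {i , j} {i′ , j′} eq =
    uncurry (cong₂ _,_) (map Fin.toℕ-injective block-injective
      (mixed-radix-injective (Fin.toℕ<n i) (Fin.toℕ<n i′) digits))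
    where
    digits : ⟦ i ⟧ + + s * + block j ≡ ⟦ i′ ⟧ + + s * + block j′ mod (s ℕ.* t)
    digits = ≡-mod-resp (⟦label⟧ i j) (⟦label⟧ i′ j′) (≡⇒≡-mod (cong ⟦_⟧ eq))

  label-strictlySurjective : ∀ v → ∃ λ u → label u ≡ v
  label-strictlySurjective v = (i , unblock q) , Fin.toℕ-injective (begin
    toℕ (label (i , unblock q))         ≡⟨ toℕ-label i (unblock q) ⟩
    toℕ i ℕ.+ s ℕ.* block (unblock q)  ≡⟨ cong₂ (λ r b → r ℕ.+ s ℕ.* b) (Fin.toℕ-fromℕ< (ℕ.m%n<n m s)) (block∘unblock q<t) ⟩
    m ℕ.% s ℕ.+ s ℕ.* q                 ≡⟨ cong (m ℕ.% s ℕ.+_) (ℕ.*-comm s q) ⟩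
    m ℕ.% s ℕ.+ q ℕ.* s                 ≡⟨ ℕ.m≡m%n+[m/n]*n m s ⟨
    m                                   ∎)
    where
    open ≡.≡-Reasoning
    m = toℕ v
    q = m ℕ./ s
    i : Fin s
    i = fromℕ< (ℕ.m%n<n m s)
    q<t : q < t
    q<t = ℕ.m<n*o⇒m/o<n (subst (m <_) (ℕ.*-comm s t) (Fin.toℕ<n v))

  right-step⇔ : ∀ i j i′ j′ → (i ≡ i′ × + t Unsigned.∣ (⟦ j′ ⟧ - ⟦ j ⟧ - 1ℤ)) ⇔
                (⟦ label (i , j) ⟧ ≡ ⟦ label (i′ , j′) ⟧ + + s * x mod (s ℕ.* t))
  right-step⇔ i j i′ j′ = mk⇔ forth back
    where
    open Equivalence
    forth : (i ≡ i′ × + t Unsigned.∣ (⟦ j′ ⟧ - ⟦ j ⟧ - 1ℤ)) →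
            ⟦ label (i , j) ⟧ ≡ ⟦ label (i′ , j′) ⟧ + + s * x mod (s ℕ.* t)
    forth (refl , t∣) = ≡-mod-resp (≡.sym (⟦label⟧ i j)) (≡.sym (⟦label⟧+s* i j′ x))
      (mixed-radix-cong {s = s} ⟦ i ⟧ (block-right⇔ .to (∣ᵤ-minus⇔ ⟦ j′ ⟧ ⟦ j ⟧ 1ℤ .to t∣)))
    back : ⟦ label (i , j) ⟧ ≡ ⟦ label (i′ , j′) ⟧ + + s * x mod (s ℕ.* t) →
           (i ≡ i′ × + t Unsigned.∣ (⟦ j′ ⟧ - ⟦ j ⟧ - 1ℤ))
    back eq = map Fin.toℕ-injective (∣ᵤ-minus⇔ ⟦ j′ ⟧ ⟦ j ⟧ 1ℤ .from ∘ block-right⇔ .from)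
      (mixed-radix-injective (Fin.toℕ<n i) (Fin.toℕ<n i′) (≡-mod-resp (⟦label⟧ i j) (⟦label⟧+s* i′ j′ x) eq))

  down-step⇔ : ∀ i j i′ j′ →
    ((toℕ i′ ≡ suc (toℕ i)) × j ≡ j′
      ⊎ (toℕ i ≡ s ℕ.∸ 1) × (toℕ i′ ≡ 0) × + t Unsigned.∣ (⟦ j′ ⟧ - ⟦ j ⟧ - d)) ⇔
    (⟦ label (i′ , j′) ⟧ ≡ ⟦ label (i , j) ⟧ + 1ℤ mod (s ℕ.* t))
  down-step⇔ i j i′ j′ = mk⇔ forth back
    where
    open Equivalence
    forth : _ → ⟦ label (i′ , j′) ⟧ ≡ ⟦ label (i , j) ⟧ + 1ℤ mod (s ℕ.* t)
    forth (inj₁ (i′≡1+i , refl)) = ≡⇒≡-mod (≡.trans (⟦label⟧-at j i′≡1+i) (≡.sym (⟦label⟧+1 i j)))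
    forth (inj₂ (last , i′≡0 , t∣)) =
      ≡-mod-resp (≡.sym (⟦label⟧-at j′ i′≡0)) (≡.sym (⟦last-label⟧+1 j last))
        (mixed-radix-cong {s = s} 0ℤ (block-wrap⇔ .to (∣ᵤ-minus⇔ ⟦ j′ ⟧ ⟦ j ⟧ d .to t∣)))
    back : ⟦ label (i′ , j′) ⟧ ≡ ⟦ label (i , j) ⟧ + 1ℤ mod (s ℕ.* t) → _
    back eq with toℕ i ℕ.≟ s ℕ.∸ 1
    ... | yes last = inj₂ (last , map₂ (∣ᵤ-minus⇔ ⟦ j′ ⟧ ⟦ j ⟧ d .from ∘ block-wrap⇔ .from)
      (mixed-radix-injective (Fin.toℕ<n i′) (ℕ.>-nonZero⁻¹ s) (≡-mod-resp (⟦label⟧ i′ j′) (⟦last-label⟧+1 j last) eq)))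
    ... | no ¬last = inj₁ (map₂ (block-injective ∘ ≡-mod-sym)
      (mixed-radix-injective (Fin.toℕ<n i′) (ℕ.≤∧≢⇒< (Fin.toℕ<n i) (¬last ∘ cong ℕ.pred))
        (≡-mod-resp (⟦label⟧ i′ j′) (⟦label⟧+1 i j) eq)))

  bundleEdge⇔step : ∀ u v → bundleEdge s t d u v ⇔ CirculantStep label (+ s * x) u v
  bundleEdge⇔step (i , j) (i′ , j′) = right-step⇔ i j i′ j′ ⊎-⇔ down-step⇔ i j i′ j′

  label-isomorphism : CycleBundleShift s t d ≅ Circulant (s ℕ.* t) (1ℤ ∷ + s * x ∷ [])
  label-isomorphism = record
    { bij = mk⤖ (label-injective , strictlySurjective⇒surjective label-strictlySurjective)
    ; adj = sym-closure⇔circulant label (+ s * x) bundleEdge⇔step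
    }

bezout⇒inverse : ∀ {t} d {x y} → (+ t - d) * x - + t * y ≡ 1ℤ → d * x ≡ - 1ℤ mod t
bezout⇒inverse {t} d {x} {y} eq = mod-by (divides (x - y) (begin
  d * x - - 1ℤ                          ≡⟨ cong (λ c → d * x + c) eq ⟨
  d * x + ((+ t - d) * x - + t * y)     ≡⟨ regroup d x (+ t) y ⟩
  (x - y) * + t                         ∎))
  where
  open ≡.≡-Reasoning
  regroup : ∀ d x t y → d * x + ((t - d) * x - t * y) ≡ (x - y) * t
  regroup = solve-∀

lemma3p2 : (s t d : ℕ) → 3 ℕ.≤ s → 3 ℕ.≤ t → 1 ℕ.≤ d → d ℕ.≤ t ℕ./ 2 → gcd t d ≡ 1 →
    (x₀ y₀ : ℤ) → (+ t - + d) ℤ.* x₀ - + t ℤ.* y₀ ≡ + 1 →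
    + 0 ℤ.≤ x₀ → x₀ ℤ.≤ + t - + 1 →
    CycleBundleShift s t (+ d) ≅ Circulant (s ℕ.* t) (+ 1 ∷ + s ℤ.* x₀ ∷ [])
lemma3p2 s t d (ℕ.s≤s _) (ℕ.s≤s _) _ _ _ x₀ y₀ bezout _ _ =
  ShiftBundle.label-isomorphism s t (+ d) x₀ (bezout⇒inverse (+ d) bezout)
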